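{- Let $G(X,Y)$ be a non-complete bipartite graph which is part-transitive under the action of a group $\Gamma$. Suppose $A$ is a fragment (in $X$ or in $Y$) such that $\emptyset\ne\gamma(A)\cap A\ne A$ for some $\gamma\in\Gamma$. If $|A|\le|\phi(A)|$, then $A\cup\gamma(A)$ and $A\cap\gamma(A)$ are both fragments (in the same part as $A$).
   Context: All graphs are finite and simple. A bipartite graph $G(X,Y)$ has vertex set the disjoint union of $X$ and $Y$, every edge joining $X$ to $Y$; it is complete if every vertex of $X$ is adjacent to every vertex of $Y$. $N(v)$ is the neighbourhood of $v$ and $N(A)=\bigcup_{v\in A}N(v)$. $\epsilon(X)=\min\{|N(A)|-|A| : \emptyset\ne A\subseteq X,\ N(A)\ne Y\}$, $\epsilon(Y)$ symmetrically. A fragment in $X$ is a nonempty $A\subseteq X$ with $N(A)\ne Y$ and $|N(A)|-|A|=\epsilon(X)$; fragments in $Y$ symmetrically. For a fragment $A$, $\phi(A)=Y\setminus N(A)$ if $A\subseteq X$ and $\phi(A)=X\setminus N(A)$ if $A\subseteq Y$. $G(X,Y)$ is part-transitive under $\Gamma$ if $\Gamma$ acts transitively on $X$ and transitively on $Y$ and preserves adjacency. -}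

module Defs where

open import Level using (Level; _⊔_)
open import Data.Bool using (Bool; true; false; _∧_; _∨_)
open import Data.Nat using (ℕ)
open import Data.Fin using (Fin)
open import Data.Fin.Properties using (_≟_)
open import Data.Fin.Subset using (Subset; ∣_∣; ∁; Nonempty) renaming (⊤ to Full)
open import Data.Vec using (lookup; tabulate)
open import Data.List using (allFin)
open import Data.Bool.ListAction using (any)
open import Data.Integer using (ℤ; +_; _-_; _≤_)
open import Data.Product using (Σ; ∃; ∃₂; _×_)
open import Relation.Nullary using (¬_)
open import Relation.Nullary.Decidable using (⌊_⌋)
open import Relation.Binary.PropositionalEquality using (_≡_; _≢_)
open import Algebra.Bundles using (Group)

record BipGraph : Set where
  field
    m n : ℕ
    E   : Fin m → Fin n → Bool

data Side : Set where
  sX sY : Side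

opp : Side → Side
opp sX = sY
opp sY = sX

module _ (G : BipGraph) where
  open BipGraph G

  size : Side → ℕ
  size sX = m
  size sY = n

  Adj : (s : Side) → Fin (size s) → Fin (size (opp s)) → Bool
  Adj sX x y = E x y
  Adj sY y x = E x y

  Complete : Set
  Complete = ∀ (x : Fin m) (y : Fin n) → E x y ≡ true

  N : (s : Side) → Subset (size s) → Subset (size (opp s))
  N s A = tabulate λ v → any (λ u → lookup A u ∧ Adj s u v) (allFin (size s))

  defect : (s : Side) → Subset (size s) → ℤ
  defect s A = + ∣ N s A ∣ - + ∣ A ∣

  Admissible : (s : Side) → Subset (size s) → Set
  Admissible s A = Nonempty A × N s A ≢ Full

  -- A is a fragment in part s: admissible and |N(A)|-|A| = ε(part s),
  -- i.e. the defect of A is the minimum over all admissible sets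
  Fragment : (s : Side) → Subset (size s) → Set
  Fragment s A = Admissible s A × (∀ B → Admissible s B → defect s A ≤ defect s B)

  φ : (s : Side) → Subset (size s) → Subset (size (opp s))
  φ s A = ∁ (N s A)

record PartTransitive {c ℓ : Level} (G : BipGraph) (Γ : Group c ℓ) : Set (c ⊔ ℓ) where
  open BipGraph G
  open Group Γ renaming (Carrier to Γ₀)
  field
    actX : Γ₀ → Fin m → Fin m
    actY : Γ₀ → Fin n → Fin n
    actX-ε : ∀ x → actX ε x ≡ x
    actY-ε : ∀ y → actY ε y ≡ y
    actX-∙ : ∀ g h x → actX (g ∙ h) x ≡ actX g (actX h x)
    actY-∙ : ∀ g h y → actY (g ∙ h) y ≡ actY g (actY h y)
    actX-≈ : ∀ {g h} → g ≈ h → ∀ x → actX g x ≡ actX h x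
    actY-≈ : ∀ {g h} → g ≈ h → ∀ y → actY g y ≡ actY h y
    preserves : ∀ g x y → E (actX g x) (actY g y) ≡ E x y
    transX : ∀ x x′ → ∃ λ g → actX g x ≡ x′
    transY : ∀ y y′ → ∃ λ g → actY g y ≡ y′

  act : (s : Side) → Γ₀ → Fin (size G s) → Fin (size G s)
  act sX = actX
  act sY = actY

  img : (s : Side) → Γ₀ → Subset (size G s) → Subset (size G s)
  img s g A = tabulate λ v →
    any (λ u → lookup A u ∧ ⌊ act s g u ≟ v ⌋) (allFin (size G s))

module Submission where

-- The argument is the classical submodularity argument.  For subsets A, B of
-- one part, N(A ∪ B) ⊆ N(A) ∪ N(B) and N(A ∩ B) ⊆ N(A) ∩ N(B); together with
-- inclusion–exclusion this makes the defect d(C) = |N(C)| - |C| submodular: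
--   d(A ∪ B) + d(A ∩ B) ≤ d(A) + d(B).
-- If A is a fragment (d(A) = ε minimal) and d(B) ≤ ε, then the right-hand side
-- is at most 2ε.  When A ∩ B is nonempty it is admissible, so d(A ∩ B) ≥ ε and
-- hence d(A ∪ B) ≤ ε.  If moreover |B| ≤ |A| ≤ |φ(A)|, the union cannot have
-- the whole other part as neighbourhood, so it is admissible as well, whence
-- d(A ∪ B) ≥ ε and d(A ∩ B) ≤ ε: both are fragments (`overlapping-fragments`).
--
-- Finally, a group element γ acts on each part
-- by a permutation preserving adjacency, so γ(A) has the same size and the same
-- defect as A; applying the abstract lemma to B = γ(A) gives the theorem.

open import Defs
open import Level using (Level)
open import Algebra.Bundles using (Group)
open import Data.Nat using (ℕ; suc; _≤_; _<_; _+_)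
open import Data.Nat.Properties
  using (+-suc; +-assoc; +-comm; +-identityʳ; +-monoˡ-≤; +-monoʳ-≤; +-mono-≤;
         +-cancelˡ-≤; ≤-reflexive; ≤-trans; <⇒≱; m≤o∸n⇒m+n≤o; +-0-commutativeMonoid; module ≤-Reasoning)
open import Data.Bool using (Bool; true; false; T; _∧_)
open import Data.Bool.Properties using (T-≡; T-∧)
open import Data.Bool.ListAction using (any)
open import Data.Fin using (Fin)
open import Data.Fin.Properties using (_≟_)
open import Data.Fin.Subset using (Subset; ∣_∣; Nonempty; _∩_; _∪_; _∈_; _⊆_)
  renaming (⊤ to Full)
open import Data.Fin.Subset.Properties
  using (⊆-antisym; ⊆⊤; p⊆q⇒∣p∣≤∣q∣; ∣⊤∣≡n; ∣∁p∣≡n∸∣p∣; ∣p∣≤n; ∣⁅x⁆∣≡1; x∈⁅y⁆⇒x≡y;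
         p∩q⊆p; p∩q⊆q; p⊆p∪q; x∈p∩q⁺; x∈p∩q⁻; x∈p∪q⁺; x∈p∪q⁻; ∩-comm)
open import Data.Fin.Permutation using (Permutation′; permutation; _⟨$⟩ʳ_)
open import Data.Vec using (_∷_; []; lookup; tabulate)
open import Data.Vec.Properties using (lookup∘tabulate; []=⇒lookup; lookup⇒[]=)
open import Data.List using (allFin)
open import Data.List.Relation.Unary.Any using (satisfied)
open import Data.List.Relation.Unary.Any.Properties using (any⁺; any⁻)
open import Data.List.Membership.Propositional using (lose)
open import Data.List.Membership.Propositional.Properties using (∈-allFin)
open import Data.Integer using (ℤ; +_; _-_; -_; +≤+) renaming (_+_ to _⊕_; _≤_ to _≤ℤ_)
import Data.Integer.Properties as ℤ
open import Data.Integer.Tactic.RingSolver using (solve-∀)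
open import Data.Product using (_×_; _,_; ∃; proj₁; proj₂)
open import Data.Sum using (inj₁; inj₂; [_,_])
open import Function using (_∘_)
open import Function.Bundles using (_⇔_; mk⇔; Equivalence)
open import Relation.Nullary using (¬_)
open import Relation.Nullary.Decidable using (⌊_⌋; toWitness; fromWitness)
open import Relation.Binary.PropositionalEquality
  using (_≡_; _≢_; refl; sym; trans; cong; cong₂; subst; module ≡-Reasoning)
import Algebra.Properties.CommutativeMonoid.Sum as CommutativeMonoidSum

open Equivalence using (to; from)

∈⇔T-lookup : ∀ {k} {x : Fin k} {p : Subset k} → x ∈ p ⇔ T (lookup p x)
∈⇔T-lookup {x = x} {p} = mk⇔ (from T-≡ ∘ []=⇒lookup) (lookup⇒[]= x p ∘ to T-≡)

∈-tabulate⇔ : ∀ {k} {f : Fin k → Bool} {x : Fin k} → x ∈ tabulate f ⇔ T (f x)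
∈-tabulate⇔ {f = f} {x} = mk⇔
  (λ x∈ → subst T (lookup∘tabulate f x) (to ∈⇔T-lookup x∈))
  (λ fx → from ∈⇔T-lookup (subst T (sym (lookup∘tabulate f x)) fx))

-- Both N(A) and γ(A) in Defs are subsets of the form {v | ∃ u ∈ A. R u v},
-- computed by a search over allFin.
Related : ∀ {k l} → Subset k → (Fin k → Fin l → Bool) → Subset l
Related {k} A R = tabulate (λ v → any (λ u → lookup A u ∧ R u v) (allFin k))

∈-Related⇔ : ∀ {k l} (A : Subset k) (R : Fin k → Fin l → Bool) {v : Fin l}
  → v ∈ Related A R ⇔ (∃ λ u → u ∈ A × T (R u v))
∈-Related⇔ {k} A R {v} = mk⇔ elim intro
  where
  search : Fin k → Bool
  search u = lookup A u ∧ R u v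
  elim : v ∈ Related A R → ∃ λ u → u ∈ A × T (R u v)
  elim v∈ with satisfied (any⁻ search (allFin k) (to ∈-tabulate⇔ v∈))
  ... | u , found with to (T-∧ {lookup A u}) found
  ...   | u∈A , r = u , from ∈⇔T-lookup u∈A , r
  intro : (∃ λ u → u ∈ A × T (R u v)) → v ∈ Related A R
  intro (u , u∈A , r) = from ∈-tabulate⇔
    (any⁺ search (lose (∈-allFin u) (from (T-∧ {lookup A u}) (to ∈⇔T-lookup u∈A , r))))

∣∪∣+∣∩∣ : ∀ {k} (p q : Subset k) → ∣ p ∪ q ∣ + ∣ p ∩ q ∣ ≡ ∣ p ∣ + ∣ q ∣
∣∪∣+∣∩∣ [] [] = refl
∣∪∣+∣∩∣ (true ∷ p) (true ∷ q) =
  cong suc (trans (+-suc ∣ p ∪ q ∣ ∣ p ∩ q ∣) (trans (cong suc (∣∪∣+∣∩∣ p q)) (sym (+-suc ∣ p ∣ ∣ q ∣))))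
∣∪∣+∣∩∣ (true ∷ p) (false ∷ q) = cong suc (∣∪∣+∣∩∣ p q)
∣∪∣+∣∩∣ (false ∷ p) (true ∷ q) = trans (cong suc (∣∪∣+∣∩∣ p q)) (sym (+-suc ∣ p ∣ ∣ q ∣))
∣∪∣+∣∩∣ (false ∷ p) (false ∷ q) = ∣∪∣+∣∩∣ p q

nonempty⇒∣p∣>0 : ∀ {k} {p : Subset k} → Nonempty p → 0 < ∣ p ∣
nonempty⇒∣p∣>0 {p = p} (x , x∈p) =
  subst (_≤ ∣ p ∣) (∣⁅x⁆∣≡1 x) (p⊆q⇒∣p∣≤∣q∣ (λ y∈⁅x⁆ → subst (_∈ p) (sym (x∈⁅y⁆⇒x≡y x y∈⁅x⁆)) x∈p))

module _ where
  open CommutativeMonoidSum +-0-commutativeMonoid using (sum; sum-cong-≗; sum-permute)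

  indicator : Bool → ℕ
  indicator true = 1
  indicator false = 0

  ∣p∣≡Σ : ∀ {k} (p : Subset k) → ∣ p ∣ ≡ sum (λ i → indicator (lookup p i))
  ∣p∣≡Σ [] = refl
  ∣p∣≡Σ (true ∷ p) = cong suc (∣p∣≡Σ p)
  ∣p∣≡Σ (false ∷ p) = ∣p∣≡Σ p

  ∣∣-permute : ∀ {k} (π : Permutation′ k) {p q : Subset k}
    → (∀ {v} → v ∈ q ⇔ π ⟨$⟩ʳ v ∈ p) → ∣ q ∣ ≡ ∣ p ∣
  ∣∣-permute π {p} {q} q⇔π⁻¹p = begin
    ∣ q ∣                                       ≡⟨ cong ∣_∣ q≡π⁻¹p ⟩
    ∣ π⁻¹p ∣                                    ≡⟨ ∣p∣≡Σ π⁻¹p ⟩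
    sum (λ i → indicator (lookup π⁻¹p i))       ≡⟨ sum-cong-≗ (λ i → cong indicator (lookup∘tabulate (λ v → lookup p (π ⟨$⟩ʳ v)) i)) ⟩
    sum (λ i → indicator (lookup p (π ⟨$⟩ʳ i))) ≡⟨ sym (sum-permute (λ i → indicator (lookup p i)) π) ⟩
    sum (λ i → indicator (lookup p i))          ≡⟨ sym (∣p∣≡Σ p) ⟩
    ∣ p ∣                                       ∎
    where
    open ≡-Reasoning
    π⁻¹p : Subset _
    π⁻¹p = tabulate (λ v → lookup p (π ⟨$⟩ʳ v))
    q≡π⁻¹p : q ≡ π⁻¹p
    q≡π⁻¹p = ⊆-antisym
      (λ v∈q → from ∈-tabulate⇔ (to ∈⇔T-lookup (to q⇔π⁻¹p v∈q)))
      (λ v∈ → from q⇔π⁻¹p (from ∈⇔T-lookup (to ∈-tabulate⇔ v∈)))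

module _ where
  open ℤ.≤-Reasoning

  difference-sum : ∀ a b c d → (+ a - + b) ⊕ (+ c - + d) ≡ + (a + c) - + (b + d)
  difference-sum a b c d = begin-equality
    (+ a - + b) ⊕ (+ c - + d)       ≡⟨ regroup (+ a) (+ b) (+ c) (+ d) ⟩
    (+ a ⊕ + c) - (+ b ⊕ + d)       ≡⟨ cong₂ _-_ (sym (ℤ.pos-+ a c)) (sym (ℤ.pos-+ b d)) ⟩
    + (a + c) - + (b + d)           ∎
    where
    regroup : ∀ (a b c d : ℤ) → (a - b) ⊕ (c - d) ≡ (a ⊕ c) - (b ⊕ d)
    regroup = solve-∀

  difference-≤⇒ : ∀ a b c d → + a - + b ≤ℤ + c - + d → a + d ≤ c + b
  difference-≤⇒ a b c d le = ℤ.drop‿+≤+ (begin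
    + (a + d)                        ≡⟨ shift a b d ⟩
    (+ a - + b) ⊕ (+ b ⊕ + d)        ≤⟨ ℤ.+-monoˡ-≤ (+ b ⊕ + d) le ⟩
    (+ c - + d) ⊕ (+ b ⊕ + d)        ≡⟨ trans (cong ((+ c - + d) ⊕_) (ℤ.+-comm (+ b) (+ d))) (sym (shift c d b)) ⟩
    + (c + b)                        ∎)
    where
    regroup : ∀ (a b d : ℤ) → a ⊕ d ≡ (a - b) ⊕ (b ⊕ d)
    regroup = solve-∀
    shift : ∀ a b d → + (a + d) ≡ (+ a - + b) ⊕ (+ b ⊕ + d)
    shift a b d = trans (ℤ.pos-+ a d) (regroup (+ a) (+ b) (+ d))

  ≤-from-sum : ∀ {x y e : ℤ} → x ⊕ y ≤ℤ e ⊕ e → e ≤ℤ y → x ≤ℤ e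
  ≤-from-sum {x} {y} {e} sum≤ e≤y = begin
    x                   ≡⟨ cancel-right x y ⟩
    (x ⊕ y) ⊕ - y       ≤⟨ ℤ.+-mono-≤ sum≤ (ℤ.neg-mono-≤ e≤y) ⟩
    (e ⊕ e) ⊕ - e       ≡⟨ sym (cancel-right e e) ⟩
    e                   ∎
    where
    cancel-right : ∀ (a b : ℤ) → a ≡ (a ⊕ b) ⊕ - b
    cancel-right = solve-∀

-- The counting core of "the union is admissible": with k the size of the
-- other part, if |B| ≤ |A|, |A| + |N(A)| ≤ k and k + |A| ≤ |N(A)| + |A ∪ B|
-- (i.e. d(A ∪ B) ≤ d(A) while N(A ∪ B) is everything), then A ∩ B is empty.
no-room-for-overlap : ∀ k a b u i na → k + a ≤ na + u → u + i ≡ a + b → b ≤ a → a + na ≤ k → i ≤ 0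
no-room-for-overlap k a b u i na cover u+i≡a+b b≤a small = +-cancelˡ-≤ (k + a) i 0 (begin
  k + a + i         ≤⟨ +-monoˡ-≤ i cover ⟩
  na + u + i        ≡⟨ +-assoc na u i ⟩
  na + (u + i)      ≡⟨ cong (λ m → na + m) u+i≡a+b ⟩
  na + (a + b)      ≤⟨ +-monoʳ-≤ na (+-monoʳ-≤ a b≤a) ⟩
  na + (a + a)      ≡⟨ trans (sym (+-assoc na a a)) (cong (_+ a) (+-comm na a)) ⟩
  a + na + a        ≤⟨ +-monoˡ-≤ a small ⟩
  k + a             ≡⟨ sym (+-identityʳ (k + a)) ⟩
  k + a + 0         ∎)
  where open ≤-Reasoning

module _ (G : BipGraph) (s : Side) where

  N-elim : ∀ A {v} → v ∈ N G s A → ∃ λ u → u ∈ A × T (Adj G s u v)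
  N-elim A = to (∈-Related⇔ A (Adj G s))

  N-intro : ∀ {A u v} → u ∈ A → T (Adj G s u v) → v ∈ N G s A
  N-intro {A} {u} u∈A uv = from (∈-Related⇔ A (Adj G s)) (u , u∈A , uv)

  N-mono : ∀ {A B} → A ⊆ B → N G s A ⊆ N G s B
  N-mono {A} A⊆B v∈NA with N-elim A v∈NA
  ... | u , u∈A , uv = N-intro (A⊆B u∈A) uv

  N-∪ : ∀ A B → N G s (A ∪ B) ⊆ N G s A ∪ N G s B
  N-∪ A B v∈ with N-elim (A ∪ B) v∈
  ... | u , u∈A∪B , uv = x∈p∪q⁺ ([ (λ u∈A → inj₁ (N-intro u∈A uv)) , (λ u∈B → inj₂ (N-intro u∈B uv)) ]
                                   (x∈p∪q⁻ A B u∈A∪B))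

  N-∩ : ∀ A B → N G s (A ∩ B) ⊆ N G s A ∩ N G s B
  N-∩ A B v∈ = x∈p∩q⁺ (N-mono (p∩q⊆p A B) v∈ , N-mono (p∩q⊆q A B) v∈)

  ∣N∣-submodular : ∀ A B → ∣ N G s (A ∪ B) ∣ + ∣ N G s (A ∩ B) ∣ ≤ ∣ N G s A ∣ + ∣ N G s B ∣
  ∣N∣-submodular A B = ≤-trans
    (+-mono-≤ (p⊆q⇒∣p∣≤∣q∣ (N-∪ A B)) (p⊆q⇒∣p∣≤∣q∣ (N-∩ A B)))
    (≤-reflexive (∣∪∣+∣∩∣ (N G s A) (N G s B)))

  defect-submodular : ∀ A B → defect G s (A ∪ B) ⊕ defect G s (A ∩ B) ≤ℤ defect G s A ⊕ defect G s B
  defect-submodular A B = begin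
    defect G s (A ∪ B) ⊕ defect G s (A ∩ B)  ≡⟨ difference-sum nU u nI i ⟩
    + (nU + nI) - + (u + i)                  ≤⟨ ℤ.+-monoˡ-≤ (- + (u + i)) (+≤+ (∣N∣-submodular A B)) ⟩
    + (na + nb) - + (u + i)                  ≡⟨ cong (λ m → + (na + nb) - + m) (∣∪∣+∣∩∣ A B) ⟩
    + (na + nb) - + (a + b)                  ≡⟨ difference-sum na a nb b ⟨
    defect G s A ⊕ defect G s B              ∎
    where
    open ℤ.≤-Reasoning
    nU nI na nb u i a b : ℕ
    nU = ∣ N G s (A ∪ B) ∣
    nI = ∣ N G s (A ∩ B) ∣
    na = ∣ N G s A ∣
    nb = ∣ N G s B ∣
    u = ∣ A ∪ B ∣
    i = ∣ A ∩ B ∣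
    a = ∣ A ∣
    b = ∣ B ∣

  admissible-⊆ : ∀ {A B} → Nonempty B → B ⊆ A → Admissible G s A → Admissible G s B
  admissible-⊆ {A} {B} ne B⊆A (_ , NA≢Full) = ne , λ NB≡Full →
    NA≢Full (⊆-antisym ⊆⊤ (λ v∈Full → N-mono B⊆A (subst (_ ∈_) (sym NB≡Full) v∈Full)))

  fragment-below : ∀ {A C} → Fragment G s A → Admissible G s C → defect G s C ≤ℤ defect G s A
    → Fragment G s C
  fragment-below (_ , minA) admC C≤A = admC , λ D admD → ℤ.≤-trans C≤A (minA D admD)

  overlapping-fragments : ∀ {A B} → Fragment G s A
    → defect G s B ≤ℤ defect G s A → ∣ B ∣ ≤ ∣ A ∣
    → Nonempty (A ∩ B) → ∣ A ∣ ≤ ∣ φ G s A ∣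
    → Fragment G s (A ∪ B) × Fragment G s (A ∩ B)
  overlapping-fragments {A} {B} fragA@(admA , minA) dB≤dA ∣B∣≤∣A∣ meet ∣A∣≤∣φA∣ =
    fragment-below fragA admU dU≤ε , fragment-below fragA admI dI≤ε
    where
    ε : ℤ
    ε = defect G s A
    k : ℕ
    k = size G (opp s)

    sum≤ : defect G s (A ∪ B) ⊕ defect G s (A ∩ B) ≤ℤ ε ⊕ ε
    sum≤ = ℤ.≤-trans (defect-submodular A B) (ℤ.+-monoʳ-≤ ε dB≤dA)

    admI : Admissible G s (A ∩ B)
    admI = admissible-⊆ meet (p∩q⊆p A B) admA

    dU≤ε : defect G s (A ∪ B) ≤ℤ ε
    dU≤ε = ≤-from-sum sum≤ (minA (A ∩ B) admI)

    -- |A| ≤ |φ(A)| = k - |N(A)|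
    small : ∣ A ∣ + ∣ N G s A ∣ ≤ k
    small = m≤o∸n⇒m+n≤o ∣ A ∣ (∣p∣≤n (N G s A)) (subst (∣ A ∣ ≤_) (∣∁p∣≡n∸∣p∣ (N G s A)) ∣A∣≤∣φA∣)

    N[A∪B]≢Full : N G s (A ∪ B) ≢ Full
    N[A∪B]≢Full full = <⇒≱ (nonempty⇒∣p∣>0 meet)
      (no-room-for-overlap k (∣ A ∣) (∣ B ∣) (∣ A ∪ B ∣) (∣ A ∩ B ∣) (∣ N G s A ∣)
        (difference-≤⇒ k (∣ A ∪ B ∣) (∣ N G s A ∣) (∣ A ∣)
          (subst (λ m → + m - + ∣ A ∪ B ∣ ≤ℤ ε) (trans (cong ∣_∣ full) (∣⊤∣≡n k)) dU≤ε))
        (∣∪∣+∣∩∣ A B) ∣B∣≤∣A∣ small)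

    admU : Admissible G s (A ∪ B)
    admU = (proj₁ meet , p⊆p∪q B (proj₁ (x∈p∩q⁻ A B (proj₂ meet)))) , N[A∪B]≢Full

    dI≤ε : defect G s (A ∩ B) ≤ℤ ε
    dI≤ε = ≤-from-sum (subst (_≤ℤ ε ⊕ ε) (ℤ.+-comm (defect G s (A ∪ B)) _) sum≤) (minA (A ∪ B) admU)

module Action {c ℓ : Level} {G : BipGraph} {Γ : Group c ℓ} (Tr : PartTransitive G Γ) where
  open PartTransitive Tr
  open Group Γ using (_⁻¹; inverseˡ; inverseʳ) renaming (Carrier to Γ₀)

  act-inv : ∀ s g v → act s g (act s (g ⁻¹) v) ≡ v
  act-inv sX g v = trans (sym (actX-∙ g (g ⁻¹) v)) (trans (actX-≈ (inverseʳ g) v) (actX-ε v))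
  act-inv sY g v = trans (sym (actY-∙ g (g ⁻¹) v)) (trans (actY-≈ (inverseʳ g) v) (actY-ε v))

  inv-act : ∀ s g v → act s (g ⁻¹) (act s g v) ≡ v
  inv-act sX g v = trans (sym (actX-∙ (g ⁻¹) g v)) (trans (actX-≈ (inverseˡ g) v) (actX-ε v))
  inv-act sY g v = trans (sym (actY-∙ (g ⁻¹) g v)) (trans (actY-≈ (inverseˡ g) v) (actY-ε v))

  act⁻¹-perm : ∀ s → Γ₀ → Permutation′ (size G s)
  act⁻¹-perm s g = permutation (act s (g ⁻¹)) (act s g) (inv-act s g) (act-inv s g)

  preserves-Adj : ∀ s g u v → Adj G s (act s g u) (act (opp s) g v) ≡ Adj G s u v
  preserves-Adj sX g u v = preserves g u v
  preserves-Adj sY g u v = preserves g v u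

  ∈img⇔ : ∀ s g A {v} → v ∈ img s g A ⇔ act s (g ⁻¹) v ∈ A
  ∈img⇔ s g A {v} = mk⇔ elim intro
    where
    moves : Fin (size G s) → Fin (size G s) → Bool
    moves u w = ⌊ act s g u ≟ w ⌋
    elim : v ∈ img s g A → act s (g ⁻¹) v ∈ A
    elim v∈ with to (∈-Related⇔ A moves) v∈
    ... | u , u∈A , gu≡v = subst (_∈ A) (trans (sym (inv-act s g u)) (cong (act s (g ⁻¹)) (toWitness gu≡v))) u∈A
    intro : act s (g ⁻¹) v ∈ A → v ∈ img s g A
    intro u∈A = from (∈-Related⇔ A moves) (act s (g ⁻¹) v , u∈A , fromWitness (act-inv s g v))

  ∈N-img⇔ : ∀ s g A {v} → v ∈ N G s (img s g A) ⇔ act (opp s) (g ⁻¹) v ∈ N G s A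
  ∈N-img⇔ s g A {v} = mk⇔ elim intro
    where
    elim : v ∈ N G s (img s g A) → act (opp s) (g ⁻¹) v ∈ N G s A
    elim v∈ with N-elim G s (img s g A) v∈
    ... | u , u∈gA , uv = N-intro G s (to (∈img⇔ s g A) u∈gA)
                            (subst T (sym (preserves-Adj s (g ⁻¹) u v)) uv)
    intro : act (opp s) (g ⁻¹) v ∈ N G s A → v ∈ N G s (img s g A)
    intro w∈ with N-elim G s A w∈
    ... | u , u∈A , uw = N-intro G s (from (∈img⇔ s g A) (subst (_∈ A) (sym (inv-act s g u)) u∈A))
                           (subst (λ y → T (Adj G s (act s g u) y)) (act-inv (opp s) g v)
                             (subst T (sym (preserves-Adj s g u (act (opp s) (g ⁻¹) v))) uw))

  ∣img∣ : ∀ s g A → ∣ img s g A ∣ ≡ ∣ A ∣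
  ∣img∣ s g A = ∣∣-permute (act⁻¹-perm s g) (∈img⇔ s g A)

  defect-img : ∀ s g A → defect G s (img s g A) ≡ defect G s A
  defect-img s g A = cong₂ (λ n a → + n - + a)
    (∣∣-permute (act⁻¹-perm (opp s) g) (∈N-img⇔ s g A))
    (∣img∣ s g A)

lemma2p2 : {c ℓ : Level} (G : BipGraph) (Γ : Group c ℓ) (T : PartTransitive G Γ)
    → ¬ Complete G
    → (s : Side) (A : Subset (size G s)) → Fragment G s A
    → (γ : Group.Carrier Γ)
    → Nonempty (PartTransitive.img T s γ A ∩ A)
    → PartTransitive.img T s γ A ∩ A ≢ A
    → ∣ A ∣ ≤ ∣ φ G s A ∣
    → Fragment G s (A ∪ PartTransitive.img T s γ A)
      × Fragment G s (A ∩ PartTransitive.img T s γ A)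
lemma2p2 G Γ Tr _ s A fragA γ meet _ ∣A∣≤∣φA∣ =
  overlapping-fragments G s fragA
    (ℤ.≤-reflexive (defect-img s γ A))
    (≤-reflexive (∣img∣ s γ A))
    (subst Nonempty (∩-comm γA A) meet)
    ∣A∣≤∣φA∣
  where
  open Action Tr
  γA : Subset (size G s)
  γA = PartTransitive.img Tr s γ A
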